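{- Let $s$ and $t$ be positive integers with $\gcd(s,t)=1$. (i) If $st$ is a perfect square, then $(1+s)(1+st+s^2t^2)$ is not divisible by $4$. (ii) If $2st$ is a perfect square, then $(1+s)(1+st)(1+s^2t^2)$ is not divisible by $4$. -}

module Defs where

open import Data.Nat using (ℕ; _*_)
open import Data.Product using (∃)
open import Relation.Binary.PropositionalEquality using (_≡_)

IsSquare : ℕ → Set
IsSquare n = ∃ λ m → m * m ≡ n

-- If gcd(s, t) = 1 and st (resp. 2st) is a square, then s is a square or
-- (in the second case) s is even; either way 1 + s ≢ 0 (mod 4), since a
-- square is 0 or 1 modulo 4.  The other factors are odd: 1 + x + x² because
-- x(x + 1) is even, and 1 + st, 1 + s²t² in case (ii) because 2st being a
-- square forces st to be even.  Finally 4 ∣ xy with y odd forces 4 ∣ x.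
module Submission where

open import Defs
open import Data.Nat using (ℕ; zero; suc; _+_; _*_; _^_; _<_)
open import Data.Nat.Properties using (+-comm; *-comm; *-assoc; *-suc; *-identityʳ; *-commutativeSemigroup)
open import Algebra.Properties.CommutativeSemigroup *-commutativeSemigroup using (x∙yz≈y∙xz)
open import Data.Nat.Divisibility
  using (_∣_; _∤_; _∣?_; ∣-antisym; ∣-trans; *-pres-∣; *-monoʳ-∣; *-cancelˡ-∣;
         ∣m+n∣m⇒∣n; m∣m*n; n∣m*n; ∣m⇒∣m*n; ∣n⇒∣m*n; quotient; m∣n⇒n≡m*quotient)
open import Data.Nat.GCD using (gcd; gcd-greatest; gcd[m,n]∣m; gcd[m,n]∣n; c*gcd[m,n]≡gcd[cm,cn])
open import Data.Nat.Coprimality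
  using (Coprime; coprime-divisor; gcd≡1⇒coprime; coprime⇒gcd≡1) renaming (sym to coprime-sym)
open import Data.Nat.Primality using (Prime; prime[2]; euclidsLemma; prime⇒nonZero; prime⇒irreducible)
open import Data.Nat.Tactic.RingSolver using (solve-∀)
open import Data.Product using (_×_; _,_)
open import Data.Sum using (inj₁; inj₂)
open import Function using (_∘_)
open import Relation.Binary.PropositionalEquality using (_≡_; refl; sym; trans; cong; subst; module ≡-Reasoning)
open import Relation.Nullary using (¬_; yes; no; contradiction)
open import Relation.Nullary.Decidable using (from-no)

private
  variable
    a b d m n o p : ℕ

data ParityView : ℕ → Set where
  even : ∀ k → ParityView (2 * k)
  odd  : ∀ k → ParityView (1 + 2 * k)

parityView : ∀ n → ParityView n
parityView zero = even 0
parityView (suc n) with parityView n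
... | even k = odd k
... | odd  k = subst ParityView (*-suc 2 k) (even (suc k))

∤m∧∣n⇒∤m+n : d ∤ m → d ∣ n → d ∤ m + n
∤m∧∣n⇒∤m+n {d} {m} {n} d∤m d∣n d∣m+n = d∤m (∣m+n∣m⇒∣n (subst (d ∣_) (+-comm m n) d∣m+n) d∣n)

2∤1 : 2 ∤ 1
2∤1 = from-no (2 ∣? 1)

4∤2 : 4 ∤ 2
4∤2 = from-no (4 ∣? 2)

2∤⇒4∤ : 2 ∤ n → 4 ∤ n
2∤⇒4∤ 2∤n = 2∤n ∘ ∣-trans (m∣m*n 2)

2∣[1+n]*n : ∀ n → 2 ∣ suc n * n
2∣[1+n]*n n with parityView n
... | even k = ∣n⇒∣m*n (suc (2 * k)) (m∣m*n k)
... | odd  k = ∣m⇒∣m*n (1 + 2 * k) (subst (2 ∣_) (*-suc 2 k) (m∣m*n (suc k)))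

2∤1+n+n*n : ∀ n → 2 ∤ 1 + n + n * n
2∤1+n+n*n n = ∤m∧∣n⇒∤m+n 2∤1 (2∣[1+n]*n n)

4∤1+n*n : ∀ n → 4 ∤ 1 + n * n
4∤1+n*n n with parityView n
... | even k = 2∤⇒4∤ (∤m∧∣n⇒∤m+n 2∤1 (∣m⇒∣m*n (2 * k) (m∣m*n k)))
... | odd  k = subst (4 ∤_) (sym (1+odd² k)) (∤m∧∣n⇒∤m+n 4∤2 (m∣m*n (k + k * k)))
  where
  1+odd² : ∀ k → 1 + (1 + 2 * k) * (1 + 2 * k) ≡ 2 + 4 * (k + k * k)
  1+odd² = solve-∀

4∤1+square : IsSquare n → 4 ∤ 1 + n
4∤1+square (g , refl) = 4∤1+n*n g

[m*n]²≡m²*n² : ∀ m n → m * n * (m * n) ≡ m ^ 2 * n ^ 2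
[m*n]²≡m²*n² = unfolded
  where
  -- m ^ 2 unfolds to m * (m * 1); the ring solver does not handle _^_.
  unfolded : ∀ m n → m * n * (m * n) ≡ m * (m * 1) * (n * (n * 1))
  unfolded = solve-∀

prime∣m*n∧∤n⇒∣m : Prime p → p ∤ n → p ∣ m * n → p ∣ m
prime∣m*n∧∤n⇒∣m {n = n} {m = m} pp p∤n p∣mn with euclidsLemma m n pp p∣mn
... | inj₁ p∣m = p∣m
... | inj₂ p∣n = contradiction p∣n p∤n

prime∣m*m⇒∣m : Prime p → p ∣ m * m → p ∣ m
prime∣m*m⇒∣m {m = m} pp p∣mm with euclidsLemma m m pp p∣mm
... | inj₁ p∣m = p∣m
... | inj₂ p∣m = p∣m

prime*n≡m*m⇒∣n : Prime p → p * n ≡ m * m → p ∣ n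
prime*n≡m*m⇒∣n {p} {n} {m} pp pn≡mm = *-cancelˡ-∣ p (subst (p * p ∣_) (sym pn≡mm) (*-pres-∣ p∣m p∣m))
  where
  instance _ = prime⇒nonZero pp
  p∣m : p ∣ m
  p∣m = prime∣m*m⇒∣m pp (subst (p ∣_) pn≡mm (m∣m*n n))

prime²∣m*n∧∤n⇒prime²∣m : Prime p → p ∤ n → p * p ∣ m * n → p * p ∣ m
prime²∣m*n∧∤n⇒prime²∣m {p} {n} {m} pp p∤n p²∣mn =
  subst (p * p ∣_) (sym m≡p*q) (*-monoʳ-∣ p (prime∣m*n∧∤n⇒∣m pp p∤n p∣q*n))
  where
  instance _ = prime⇒nonZero pp
  p∣m : p ∣ m
  p∣m = prime∣m*n∧∤n⇒∣m pp p∤n (∣-trans (m∣m*n p) p²∣mn)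
  q : ℕ
  q = quotient p∣m
  m≡p*q : m ≡ p * q
  m≡p*q = m∣n⇒n≡m*quotient p∣m
  p∣q*n : p ∣ q * n
  p∣q*n = *-cancelˡ-∣ p (subst (p * p ∣_) (trans (cong (_* n) m≡p*q) (*-assoc p q n)) p²∣mn)

4∤m⇒4∤m*odd : 2 ∤ n → 4 ∤ m → 4 ∤ m * n
4∤m⇒4∤m*odd 2∤n 4∤m = 4∤m ∘ prime²∣m*n∧∤n⇒prime²∣m prime[2] 2∤n

prime∤⇒coprime : Prime p → p ∤ n → Coprime p n
prime∤⇒coprime pp p∤n (i∣p , i∣n) with prime⇒irreducible pp i∣p
... | inj₁ i≡1 = i≡1
... | inj₂ refl = contradiction i∣n p∤n

coprime-*ʳ : Coprime m n → Coprime m o → Coprime m (n * o)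
coprime-*ʳ {m} {n} m⊥n m⊥o {i} (i∣m , i∣no) = m⊥o (i∣m , coprime-divisor i⊥n i∣no)
  where
  i⊥n : Coprime i n
  i⊥n (j∣i , j∣n) = m⊥n (∣-trans j∣i i∣m , j∣n)

coprime-square-factor : Coprime a b → a * b ≡ m * m → IsSquare a
coprime-square-factor {a} {b} {m} a⊥b ab≡mm = g , ∣-antisym g*g∣a a∣g*g
  where
  open ≡-Reasoning
  g : ℕ
  g = gcd a m
  a∣c*gcd : ∀ c {x y} → a ∣ c * x → a ∣ c * y → a ∣ c * gcd x y
  a∣c*gcd c {x} {y} a∣cx a∣cy = subst (a ∣_) (sym (c*gcd[m,n]≡gcd[cm,cn] c x y)) (gcd-greatest a∣cx a∣cy)
  gcd[a*a,a*b]≡a : gcd (a * a) (a * b) ≡ a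
  gcd[a*a,a*b]≡a = begin
    gcd (a * a) (a * b) ≡⟨ c*gcd[m,n]≡gcd[cm,cn] a a b ⟨
    a * gcd a b         ≡⟨ cong (a *_) (coprime⇒gcd≡1 a⊥b) ⟩
    a * 1               ≡⟨ *-identityʳ a ⟩
    a                   ∎
  g*g∣a : g * g ∣ a
  g*g∣a = subst (g * g ∣_) gcd[a*a,a*b]≡a (gcd-greatest
    (*-pres-∣ (gcd[m,n]∣m a m) (gcd[m,n]∣m a m))
    (subst (g * g ∣_) (sym ab≡mm) (*-pres-∣ (gcd[m,n]∣n a m) (gcd[m,n]∣n a m))))
  -- g * g = g * gcd a m, and g * m = m * gcd a m with a ∣ m * m = a * b.
  a∣g*g : a ∣ g * g
  a∣g*g = a∣c*gcd g (n∣m*n g)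
    (subst (a ∣_) (*-comm m g) (a∣c*gcd m (n∣m*n m) (subst (a ∣_) ab≡mm (m∣m*n b))))

lemma3p3 : (s t : ℕ) → 0 < s → 0 < t → gcd s t ≡ 1 →
    (IsSquare (s * t) → ¬ (4 ∣ (1 + s) * (1 + s * t + s ^ 2 * t ^ 2)))
    × (IsSquare (2 * s * t) → ¬ (4 ∣ (1 + s) * (1 + s * t) * (1 + s ^ 2 * t ^ 2)))
lemma3p3 s t _ _ gcd[s,t]≡1 = part-i , part-ii
  where
  s⊥t : Coprime s t
  s⊥t = gcd≡1⇒coprime gcd[s,t]≡1

  part-i : IsSquare (s * t) → 4 ∤ (1 + s) * (1 + s * t + s ^ 2 * t ^ 2)
  part-i (m , m*m≡s*t) = 4∤m⇒4∤m*odd 2∤1+st+s²t² (4∤1+square s-square)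
    where
    s-square : IsSquare s
    s-square = coprime-square-factor {m = m} s⊥t (sym m*m≡s*t)
    2∤1+st+s²t² : 2 ∤ 1 + s * t + s ^ 2 * t ^ 2
    2∤1+st+s²t² = subst (λ x → 2 ∤ 1 + s * t + x) ([m*n]²≡m²*n² s t) (2∤1+n+n*n (s * t))

  part-ii : IsSquare (2 * s * t) → 4 ∤ (1 + s) * (1 + s * t) * (1 + s ^ 2 * t ^ 2)
  part-ii (m , m*m≡2*s*t) = 4∤m⇒4∤m*odd 2∤1+s²t² (4∤m⇒4∤m*odd 2∤1+st 4∤1+s)
    where
    2*[s*t]≡m*m : 2 * (s * t) ≡ m * m
    2*[s*t]≡m*m = trans (sym (*-assoc 2 s t)) (sym m*m≡2*s*t)
    2∣st : 2 ∣ s * t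
    2∣st = prime*n≡m*m⇒∣n {m = m} prime[2] 2*[s*t]≡m*m
    2∤1+st : 2 ∤ 1 + s * t
    2∤1+st = ∤m∧∣n⇒∤m+n 2∤1 2∣st
    2∤1+s²t² : 2 ∤ 1 + s ^ 2 * t ^ 2
    2∤1+s²t² = subst (λ x → 2 ∤ 1 + x) ([m*n]²≡m²*n² s t) (∤m∧∣n⇒∤m+n 2∤1 (∣m⇒∣m*n (s * t) 2∣st))
    4∤1+s : 4 ∤ 1 + s
    4∤1+s with 2 ∣? s
    ... | yes 2∣s = 2∤⇒4∤ (∤m∧∣n⇒∤m+n 2∤1 2∣s)
    ... | no  2∤s = 4∤1+square (coprime-square-factor {m = m} s⊥2t (trans (x∙yz≈y∙xz s 2 t) 2*[s*t]≡m*m))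
      where
      s⊥2t : Coprime s (2 * t)
      s⊥2t = coprime-*ʳ (coprime-sym (prime∤⇒coprime prime[2] 2∤s)) s⊥t
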